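{- Let $M$ be a binary matroid, let $H$ be a circuit-hyperplane of $M$, and let $M'$ be obtained from $M$ by relaxing $H$. Then $M'$ is binary if and only if $M$ is isomorphic to $U_{n-1,n}\oplus U_{1,k}$ for some integers $n,k\geq 1$.
   Context: A circuit-hyperplane of $M$ is a set that is both a circuit and a hyperplane of $M$. Relaxing it produces the matroid on $E(M)$ whose bases are the bases of $M$ together with $H$. -}

module Defs where

open import Data.Nat using (ℕ; zero; suc; _+_)
open import Data.Bool using (Bool; true; false; _∧_; _xor_)
open import Data.Fin using (Fin)
open import Data.Fin.Subset using (Subset; _∈_; _∉_; _⊆_; _⊂_; _∪_; _-_; ⁅_⁆; ∣_∣; Nonempty)
open import Data.Vec using (Vec; lookup; tabulate; take; drop; foldr)
open import Data.Product using (Σ; ∃; _×_; _,_)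
open import Relation.Binary.PropositionalEquality using (_≡_)
open import Relation.Nullary using (¬_)
open import Function.Bundles using (_⇔_; _↔_; Inverse)

record Matroid (m : ℕ) : Set₁ where
  field
    Base : Subset m → Set
    base-exists : ∃ λ B → Base B
    exchange : ∀ B₁ B₂ x → Base B₁ → Base B₂ → x ∈ B₁ → x ∉ B₂ →
               ∃ λ y → y ∈ B₂ × y ∉ B₁ × Base ((B₁ - x) ∪ ⁅ y ⁆)

open Matroid public

module _ {m : ℕ} (M : Matroid m) where

  Indep : Subset m → Set
  Indep X = ∃ λ B → Base M B × X ⊆ B

  Spanning : Subset m → Set
  Spanning X = ∃ λ B → Base M B × B ⊆ X

  IsCircuit : Subset m → Set
  IsCircuit C = ¬ Indep C × (∀ Y → Y ⊂ C → Indep Y)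

  IsHyperplane : Subset m → Set
  IsHyperplane H = ¬ Spanning H × (∀ e → e ∉ H → Spanning (H ∪ ⁅ e ⁆))

  IsCircuitHyperplane : Subset m → Set
  IsCircuitHyperplane H = IsCircuit H × IsHyperplane H

IsRelaxation : ∀ {m} → Matroid m → Subset m → Matroid m → Set
IsRelaxation M H M' = ∀ X → Base M' X ⇔ (Base M X Data.Sum.⊎ X ≡ H)
  where import Data.Sum

-- GF(2)-representability.  GF(2) is Bool with xor as addition and ∧ as
-- multiplication.  A : Fin r → Fin m → Bool is an r × m matrix over GF(2).

linComb : ∀ {r m} → (Fin r → Fin m → Bool) → Vec Bool m → Fin r → Bool
linComb {m = m} A c i = foldr (λ _ → Bool) _xor_ false (tabulate λ j → lookup c j ∧ A i j)

ColumnsIndep : ∀ {r m} → (Fin r → Fin m → Bool) → Subset m → Set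
ColumnsIndep A X = ∀ c → c ⊆ X → Nonempty c → ¬ (∀ i → linComb A c i ≡ false)

IsBinary : ∀ {m} → Matroid m → Set
IsBinary {m} M = ∃ λ r → Σ (Fin r → Fin m → Bool) λ A →
  ∀ X → Indep M X ⇔ ColumnsIndep A X

UniformBase : (r n : ℕ) → Subset n → Set
UniformBase r n X = ∣ X ∣ ≡ r

DirectSumBase : ∀ {a b} → (Subset a → Set) → (Subset b → Set) → Subset (a + b) → Set
DirectSumBase {a} {b} P Q X = P (take a X) × Q (drop a X)

image : ∀ {m m'} → Fin m ↔ Fin m' → Subset m → Subset m'
image σ X = tabulate λ j → lookup X (Inverse.from σ j)

IsoToBases : ∀ {m m'} → Matroid m → (Subset m' → Set) → Set
IsoToBases {m} {m'} M Q = Σ (Fin m ↔ Fin m') λ σ → ∀ X → Base M X ⇔ Q (image σ X)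

IsoToU⊕U : ∀ {m} → Matroid m → (n k : ℕ) → Set
IsoToU⊕U M n k = IsoToBases M (DirectSumBase {n} {k} (UniformBase (Data.Nat._∸_ n 1) n) (UniformBase 1 k))
  where import Data.Nat

module Submission where

-- Both sides are shown equivalent to the condition OneOutside M H: no base
-- of M has two elements outside H.  The basic matroid fact (replace-base) is
-- that (H - h) ∪ {e} is a base of M for every h ∈ H and e ∉ H; under
-- OneOutside these are all the bases.  Then:
--  * M' binary ⇒ OneOutside: in M' every H ∪ {e} is a circuit, and over
--    GF(2) the circuits H ∪ {e}, H ∪ {f} add up to the dependent set {e, f};
--  * OneOutside ⇒ M' binary: an explicit matrix, with unit columns on H and
--    the indicator vector of H as every other column;
--  * U_{n-1,n} ⊕ U_{1,k} ⇒ OneOutside: base exchanges preserve the sizes of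
--    the blocks, so H and its complement each fill a block;
--  * OneOutside ⇒ U_{n-1,n} ⊕ U_{1,k}: split Fin m into H and its complement.

open import Defs
open import Data.Nat using (ℕ; zero; suc; _≥_; _<_; _∸_; _+_; s≤s; z≤n)
open import Data.Nat.Properties
  using (<-irrefl; n≮0; m∸[m∸n]≡n) renaming (suc-injective to ℕ-suc-injective)
open import Data.Bool using (Bool; true; false; not; _∧_; _xor_; if_then_else_)
open import Data.Bool.Properties
  using (∧-distribʳ-xor; ∧-zeroʳ; ∧-identityʳ; xor-same; xor-identityʳ; xor-∧-commutativeRing)
open import Data.Fin using (Fin; zero; suc; _↑ˡ_; _↑ʳ_; splitAt; fromℕ<)
open import Data.Fin.Properties
  using (_≟_; any?; suc-injective; +↔⊎; ↑ˡ-injective; ↑ʳ-injective;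
         splitAt-↑ˡ; splitAt-↑ʳ; splitAt⁻¹-↑ˡ; splitAt⁻¹-↑ʳ)
open import Data.Fin.Subset
  using (Subset; _∈_; _∉_; _⊆_; _⊂_; _∪_; _─_; _-_; ⁅_⁆; ∁; ∣_∣; Nonempty)
  renaming (⊥ to ∅)
open import Data.Fin.Subset.Properties
  using (_∈?_; drop-there; ⊆-antisym; Empty-unique;
         x∈p∪q⁻; x∈p∪q⁺; p─q⊆p; x∈p∧x≢y⇒x∈p-y; x∈p⇒p-x⊂p;
         x∈⁅x⁆; x∈⁅y⁆⇒x≡y; x≢y⇒x∉⁅y⁆; x∉⁅y⁆⇒x≢y;
         x∉p⇒x∈∁p; x∈∁p⇒x∉p; x∉∁p⇒x∈p; x∈p⇒x∉∁p;
         x∈p⇒∣p-x∣<∣p∣; ∣∁p∣≡n∸∣p∣; ∣⁅x⁆∣≡1; p⊂q⇒∣p∣<∣q∣)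
open import Data.Vec using (Vec; []; _∷_; here; there; lookup; tabulate; foldr; zipWith; take; drop)
open import Data.Vec.Properties
  using ([]=⇒lookup; lookup⇒[]=; lookup-zipWith; lookup∘tabulate; tabulate∘lookup; tabulate-cong)
open import Data.Product using (Σ; ∃; _×_; _,_; proj₁; proj₂)
open import Data.Sum using (_⊎_; inj₁; inj₂)
import Data.Sum as Sum
open import Data.Empty using (⊥; ⊥-elim)
open import Relation.Binary.PropositionalEquality
open import Relation.Nullary using (¬_; does; yes; no; ¬?; _×-dec_)
open import Relation.Nullary.Decidable using (decidable-stable; dec-true; dec-false)
open import Function using (_∘_; case_of_)
open import Function.Bundles using (_⇔_; mk⇔; Equivalence; _↔_; Inverse; mk↔ₛ′)
open import Function.Construct.Composition using (_↔-∘_)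
open import Function.Construct.Symmetry using (↔-sym)
open import Function.Properties.Equivalence using () renaming (trans to ⇔-trans)
open import Algebra.Bundles using (CommutativeRing)
import Algebra.Properties.CommutativeSemigroup as CommSemigroupProperties

true≢false : true ≢ false
true≢false ()

∈─⇒∉ : ∀ {m} (p q : Subset m) {x : Fin m} → x ∈ p ─ q → x ∉ q
∈─⇒∉ (_ ∷ p) (true  ∷ q) {zero}  ()         _
∈─⇒∉ (_ ∷ p) (false ∷ q) {zero}  _          ()
∈─⇒∉ (_ ∷ p) (_     ∷ q) {suc x} (there x∈) (there x∈q) = ∈─⇒∉ p q x∈ x∈q

module _ {m : ℕ} where

  ⊆-or-witness : (X Y : Subset m) → X ⊆ Y ⊎ ∃ λ x → x ∈ X × x ∉ Y
  ⊆-or-witness X Y with any? (λ x → (x ∈? X) ×-dec ¬? (x ∈? Y))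
  ... | yes w = inj₂ w
  ... | no ¬w = inj₁ λ {x} x∈X → decidable-stable (x ∈? Y) (λ x∉Y → ¬w (x , x∈X , x∉Y))

  lookup-∉ : ∀ {p : Subset m} {x} → x ∉ p → lookup p x ≡ false
  lookup-∉ {p} {x} x∉p with lookup p x in eq
  ... | true  = ⊥-elim (x∉p (lookup⇒[]= x p eq))
  ... | false = refl

  ∉-lookup : ∀ {p : Subset m} {x} → lookup p x ≡ false → x ∉ p
  ∉-lookup p[x]≡false x∈p = true≢false (trans (sym ([]=⇒lookup x∈p)) p[x]≡false)

  ∈-lookup : ∀ {p : Subset m} {x} → lookup p x ≡ true → x ∈ p
  ∈-lookup {p} {x} = lookup⇒[]= x p

module _ {m : ℕ} where

  ∈-remove⁻ : ∀ {p : Subset m} {x y} → x ∈ p - y → x ∈ p × x ≢ y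
  ∈-remove⁻ {p} {y = y} x∈ =
    p─q⊆p p ⁅ y ⁆ x∈ , λ { refl → ∈─⇒∉ p ⁅ y ⁆ x∈ (x∈⁅x⁆ y) }

  ∈-∪⁅⁆⁻ : ∀ {p : Subset m} {x y} → x ∈ p ∪ ⁅ y ⁆ → x ∈ p ⊎ x ≡ y
  ∈-∪⁅⁆⁻ {p} {y = y} x∈ with x∈p∪q⁻ p ⁅ y ⁆ x∈
  ... | inj₁ x∈p   = inj₁ x∈p
  ... | inj₂ x∈⁅y⁆ = inj₂ (x∈⁅y⁆⇒x≡y y x∈⁅y⁆)

  ∈-∪⁅⁆-old : ∀ {p : Subset m} {x y} → x ∈ p → x ∈ p ∪ ⁅ y ⁆
  ∈-∪⁅⁆-old x∈p = x∈p∪q⁺ (inj₁ x∈p)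

  ∈-∪⁅⁆-new : ∀ {p : Subset m} {y} → y ∈ p ∪ ⁅ y ⁆
  ∈-∪⁅⁆-new {y = y} = x∈p∪q⁺ (inj₂ (x∈⁅x⁆ y))

  replace : Subset m → Fin m → Fin m → Subset m
  replace p h e = (p - h) ∪ ⁅ e ⁆

  ∈-replace⁻ : ∀ {p h e x} → x ∈ replace p h e → (x ∈ p × x ≢ h) ⊎ x ≡ e
  ∈-replace⁻ x∈ with ∈-∪⁅⁆⁻ x∈
  ... | inj₁ x∈p-h = inj₁ (∈-remove⁻ x∈p-h)
  ... | inj₂ x≡e   = inj₂ x≡e

  ∈-replace-kept : ∀ {p h e x} → x ∈ p → x ≢ h → x ∈ replace p h e
  ∈-replace-kept x∈p x≢h = ∈-∪⁅⁆-old (x∈p∧x≢y⇒x∈p-y x∈p x≢h)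

  ∈-replace-new : ∀ {p h e} → e ∈ replace p h e
  ∈-replace-new = ∈-∪⁅⁆-new

  ∉-replace-old : ∀ {p h e} → h ≢ e → h ∉ replace p h e
  ∉-replace-old h≢e h∈ with ∈-replace⁻ h∈
  ... | inj₁ (_ , h≢h) = h≢h refl
  ... | inj₂ h≡e       = h≢e h≡e

  replace-⊆ : ∀ {p h e B} → p - h ⊆ B → e ∈ B → replace p h e ⊆ B
  replace-⊆ p-h⊆B e∈B x∈ with ∈-∪⁅⁆⁻ x∈
  ... | inj₁ x∈p-h = p-h⊆B x∈p-h
  ... | inj₂ refl  = e∈B

  -- Symmetric difference, the sum of two vectors over GF(2).
  _Δ_ : Subset m → Subset m → Subset m
  p Δ q = zipWith _xor_ p q

  ∈-Δ⁺ : ∀ {p q x} → x ∈ p → x ∉ q → x ∈ p Δ q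
  ∈-Δ⁺ {p} {q} {x} x∈p x∉q = ∈-lookup (begin
    lookup (p Δ q) x           ≡⟨ lookup-zipWith _xor_ x p q ⟩
    lookup p x xor lookup q x  ≡⟨ cong₂ _xor_ ([]=⇒lookup x∈p) (lookup-∉ x∉q) ⟩
    true                       ∎)
    where open ≡-Reasoning

  ∈-Δ⁻ : ∀ {p q x} → x ∈ p Δ q → (x ∈ p × x ∉ q) ⊎ (x ∉ p × x ∈ q)
  ∈-Δ⁻ {p} {q} {x} x∈
    with lookup p x in ep | lookup q x in eq
       | trans (sym ([]=⇒lookup x∈)) (lookup-zipWith _xor_ x p q)
  ... | true  | false | _ = inj₁ (∈-lookup ep , ∉-lookup eq)
  ... | false | true  | _ = inj₂ (∉-lookup ep , ∈-lookup eq)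
  ... | true  | true  | ()
  ... | false | false | ()

  restrict : ∀ {a} → (Fin a → Fin m) → Subset m → Subset a
  restrict f X = tabulate λ i → lookup X (f i)

  ∈-restrict⁺ : ∀ {a} {f : Fin a → Fin m} {X i} → f i ∈ X → i ∈ restrict f X
  ∈-restrict⁺ {f = f} {X} {i} fi∈X =
    ∈-lookup (trans (lookup∘tabulate _ i) ([]=⇒lookup fi∈X))

  ∈-restrict⁻ : ∀ {a} {f : Fin a → Fin m} {X i} → i ∈ restrict f X → f i ∈ X
  ∈-restrict⁻ {f = f} {X} {i} i∈ =
    ∈-lookup (trans (sym (lookup∘tabulate _ i)) ([]=⇒lookup i∈))

  restrict-⊂ : ∀ {a} (f : Fin a → Fin m) {X₁ X₂ v i} → f i ∈ X₁ → f i ∉ X₂ →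
               X₂ ⊆ X₁ ∪ ⁅ v ⁆ → (∀ i' → f i' ≢ v) → restrict f X₂ ⊂ restrict f X₁
  restrict-⊂ f {X₁} {X₂} {v} {i} fi∈X₁ fi∉X₂ X₂⊆ f≢v =
    shrink , i , ∈-restrict⁺ fi∈X₁ , fi∉X₂ ∘ ∈-restrict⁻
    where
    shrink : restrict f X₂ ⊆ restrict f X₁
    shrink {i'} i'∈ with ∈-∪⁅⁆⁻ (X₂⊆ (∈-restrict⁻ i'∈))
    ... | inj₁ fi'∈X₁ = ∈-restrict⁺ fi'∈X₁
    ... | inj₂ fi'≡v  = ⊥-elim (f≢v i' fi'≡v)

  restrict-replace-outside : ∀ {a} {f : Fin a → Fin m} {p h e i₀} →
    (∀ {i i'} → f i ≡ f i' → i ≡ i') → (∀ i → f i ∉ p) → f i₀ ≡ e →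
    restrict f (replace p h e) ≡ ⁅ i₀ ⁆
  restrict-replace-outside {f = f} {p} {h} {e} {i₀} f-inj f∉p fi₀≡e = ⊆-antisym ⊆⁅i₀⁆ ⁅i₀⁆⊆
    where
    ⊆⁅i₀⁆ : restrict f (replace p h e) ⊆ ⁅ i₀ ⁆
    ⊆⁅i₀⁆ {i} i∈ with ∈-replace⁻ {p} {h} {e} (∈-restrict⁻ i∈)
    ... | inj₁ (fi∈p , _) = ⊥-elim (f∉p i fi∈p)
    ... | inj₂ fi≡e = subst (_∈ ⁅ i₀ ⁆) (sym (f-inj (trans fi≡e (sym fi₀≡e)))) (x∈⁅x⁆ i₀)
    ⁅i₀⁆⊆ : ⁅ i₀ ⁆ ⊆ restrict f (replace p h e)
    ⁅i₀⁆⊆ i∈ rewrite x∈⁅y⁆⇒x≡y i₀ i∈ = ∈-restrict⁺ (subst (_∈ replace p h e) (sym fi₀≡e) ∈-replace-new)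

  restrict-replace-inside : ∀ {a} {f : Fin a → Fin m} {p h e i₀} →
    (∀ {i i'} → f i ≡ f i' → i ≡ i') → (∀ i → f i ∈ p) → f i₀ ≡ h → e ∉ p →
    restrict f (replace p h e) ≡ ∁ ⁅ i₀ ⁆
  restrict-replace-inside {f = f} {p} {h} {e} {i₀} f-inj f∈p fi₀≡h e∉p = ⊆-antisym ⊆∁⁅i₀⁆ ∁⁅i₀⁆⊆
    where
    ⊆∁⁅i₀⁆ : restrict f (replace p h e) ⊆ ∁ ⁅ i₀ ⁆
    ⊆∁⁅i₀⁆ {i} i∈ with ∈-replace⁻ {p} {h} {e} (∈-restrict⁻ i∈)
    ... | inj₁ (_ , fi≢h) = x∉p⇒x∈∁p (x≢y⇒x∉⁅y⁆ λ { refl → fi≢h fi₀≡h })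
    ... | inj₂ refl       = ⊥-elim (e∉p (f∈p i))
    ∁⁅i₀⁆⊆ : ∁ ⁅ i₀ ⁆ ⊆ restrict f (replace p h e)
    ∁⁅i₀⁆⊆ {i} i∈ = ∈-restrict⁺ (∈-replace-kept (f∈p i) λ fi≡h →
      x∉⁅y⁆⇒x≢y (x∈∁p⇒x∉p i∈) (f-inj (trans fi≡h (sym fi₀≡h))))

inhabited : ∀ {n} → Fin n → n ≥ 1
inhabited zero    = s≤s z≤n
inhabited (suc _) = s≤s z≤n

∣p∣≡0⇒p≡∅ : ∀ {m} (p : Subset m) → ∣ p ∣ ≡ 0 → p ≡ ∅
∣p∣≡0⇒p≡∅ p ∣p∣≡0 = Empty-unique λ (x , x∈p) →
  n≮0 (subst (∣ p - x ∣ <_) ∣p∣≡0 (x∈p⇒∣p-x∣<∣p∣ x∈p))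

∣p∣≡1⇒singleton : ∀ {m} (p : Subset m) → ∣ p ∣ ≡ 1 → ∃ λ i → p ≡ ⁅ i ⁆
∣p∣≡1⇒singleton (true  ∷ p) ∣p∣≡1 = zero , cong (true ∷_) (∣p∣≡0⇒p≡∅ p (ℕ-suc-injective ∣p∣≡1))
∣p∣≡1⇒singleton (false ∷ p) ∣p∣≡1 with ∣p∣≡1⇒singleton p ∣p∣≡1
... | i , refl = suc i , refl

-- Sums over GF(2)

-- The GF(2)-sum of the values of f; by definition
-- linComb A c i = Σ₂ (λ j → lookup c j ∧ A i j).
Σ₂ : ∀ {m} → (Fin m → Bool) → Bool
Σ₂ f = foldr (λ _ → Bool) _xor_ false (tabulate f)

module _ where
  open CommSemigroupProperties (CommutativeRing.+-commutativeSemigroup xor-∧-commutativeRing)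
    using (interchange)

  Σ₂-cong : ∀ {m} {f g : Fin m → Bool} → (∀ j → f j ≡ g j) → Σ₂ f ≡ Σ₂ g
  Σ₂-cong f≗g = cong (foldr (λ _ → Bool) _xor_ false) (tabulate-cong f≗g)

  Σ₂-xor : ∀ {m} (f g : Fin m → Bool) → Σ₂ (λ j → f j xor g j) ≡ Σ₂ f xor Σ₂ g
  Σ₂-xor {zero}  f g = refl
  Σ₂-xor {suc m} f g = trans
    (cong ((f zero xor g zero) xor_) (Σ₂-xor (λ j → f (suc j)) (λ j → g (suc j))))
    (interchange (f zero) (g zero) (Σ₂ (λ j → f (suc j))) (Σ₂ (λ j → g (suc j))))

  Σ₂-∧ʳ : ∀ {m} (f : Fin m → Bool) b → Σ₂ (λ j → f j ∧ b) ≡ Σ₂ f ∧ b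
  Σ₂-∧ʳ {zero}  f b = refl
  Σ₂-∧ʳ {suc m} f b = trans
    (cong ((f zero ∧ b) xor_) (Σ₂-∧ʳ (λ j → f (suc j)) b))
    (sym (∧-distribʳ-xor b (f zero) (Σ₂ (λ j → f (suc j)))))

  Σ₂-zero : ∀ {m} (f : Fin m → Bool) → (∀ j → f j ≡ false) → Σ₂ f ≡ false
  Σ₂-zero {zero}  f f≡0 = refl
  Σ₂-zero {suc m} f f≡0 rewrite f≡0 zero = Σ₂-zero (λ j → f (suc j)) (λ j → f≡0 (suc j))

  Σ₂-single : ∀ {m} (f : Fin m → Bool) e → (∀ j → j ≢ e → f j ≡ false) → Σ₂ f ≡ f e
  Σ₂-single {suc m} f zero    f≡0 =
    trans (cong (f zero xor_) (Σ₂-zero (λ j → f (suc j)) (λ j → f≡0 (suc j) λ ())))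
          (xor-identityʳ (f zero))
  Σ₂-single {suc m} f (suc e) f≡0 rewrite f≡0 zero (λ ()) =
    Σ₂-single (λ j → f (suc j)) e (λ j j≢e → f≡0 (suc j) (j≢e ∘ suc-injective))

InKernel : ∀ {r m} → (Fin r → Fin m → Bool) → Subset m → Set
InKernel A c = ∀ i → linComb A c i ≡ false

linComb-Δ : ∀ {r m} (A : Fin r → Fin m → Bool) (c d : Subset m) i →
            linComb A (c Δ d) i ≡ linComb A c i xor linComb A d i
linComb-Δ A c d i = trans (Σ₂-cong distrib)
  (Σ₂-xor (λ j → lookup c j ∧ A i j) (λ j → lookup d j ∧ A i j))
  where
  distrib : ∀ j → lookup (c Δ d) j ∧ A i j ≡ (lookup c j ∧ A i j) xor (lookup d j ∧ A i j)
  distrib j = trans (cong (_∧ A i j) (lookup-zipWith _xor_ j c d))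
                    (∧-distribʳ-xor (A i j) (lookup c j) (lookup d j))

linComb-⁅⁆ : ∀ {r m} (A : Fin r → Fin m → Bool) j i → linComb A ⁅ j ⁆ i ≡ A i j
linComb-⁅⁆ A j i = trans
  (Σ₂-single (λ k → lookup ⁅ j ⁆ k ∧ A i k) j
     (λ k k≢j → cong (_∧ A i k) (lookup-∉ (x≢y⇒x∉⁅y⁆ k≢j))))
  (cong (_∧ A i j) ([]=⇒lookup (x∈⁅x⁆ j)))

kernel-Δ : ∀ {r m} (A : Fin r → Fin m → Bool) {c d} → InKernel A c → InKernel A d → InKernel A (c Δ d)
kernel-Δ A {c} {d} Ac≡0 Ad≡0 i =
  trans (linComb-Δ A c d i) (cong₂ _xor_ (Ac≡0 i) (Ad≡0 i))

-- Bases, and the bases through a circuit-hyperplane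

module _ {m : ℕ} (M : Matroid m) where

  base-⊆-base : ∀ {B₁ B₂} → Base M B₁ → Base M B₂ → B₁ ⊆ B₂ → B₁ ≡ B₂
  base-⊆-base {B₁} {B₂} b₁ b₂ B₁⊆B₂ = ⊆-antisym B₁⊆B₂ B₂⊆B₁
    where
    B₂⊆B₁ : B₂ ⊆ B₁
    B₂⊆B₁ {x} x∈B₂ with x ∈? B₁
    ... | yes x∈B₁ = x∈B₁
    ... | no  x∉B₁ with exchange M B₂ B₁ x b₂ b₁ x∈B₂ x∉B₁
    ... | y , y∈B₁ , y∉B₂ , _ = ⊥-elim (y∉B₂ (B₁⊆B₂ y∈B₁))

OneOutside : ∀ {m} → Matroid m → Subset m → Set
OneOutside M H = ∀ {B e f} → Base M B → e ∈ B → f ∈ B → e ∉ H → f ∉ H → e ≡ f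

module CircuitHyperplane {m : ℕ} (M : Matroid m) {H : Subset m}
                         (ch : IsCircuitHyperplane M H) where

  H⊈base : ∀ {B} → Base M B → ¬ (H ⊆ B)
  H⊈base b H⊆B = proj₁ (proj₁ ch) (_ , b , H⊆B)

  base⊈H : ∀ {B} → Base M B → ¬ (B ⊆ H)
  base⊈H b B⊆H = proj₁ (proj₂ ch) (_ , b , B⊆H)

  base-misses-H : ∀ {B} → Base M B → ∃ λ h → h ∈ H × h ∉ B
  base-misses-H {B} b with ⊆-or-witness H B
  ... | inj₁ H⊆B = ⊥-elim (H⊈base b H⊆B)
  ... | inj₂ w   = w

  base-meets-outside : ∀ {B} → Base M B → ∃ λ e → e ∈ B × e ∉ H
  base-meets-outside {B} b with ⊆-or-witness B H
  ... | inj₁ B⊆H = ⊥-elim (base⊈H b B⊆H)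
  ... | inj₂ w   = w

  -- Fix h ∈ H, e ∉ H, and a base B₀ inside the spanning set H ∪ {e}.  If a
  -- base B contains H - h, exchanging any x ∉ H ∪ {e} of B against B₀ must
  -- bring in e: bringing in h would put all of H into a base.
  module TradeTowards {h e : Fin m} (h∈H : h ∈ H) (e∉H : e ∉ H) where
    private
      spanning = proj₂ (proj₂ ch) e e∉H
      B₀ = proj₁ spanning
      b₀ = proj₁ (proj₂ spanning)
      B₀⊆H+e : B₀ ⊆ H ∪ ⁅ e ⁆
      B₀⊆H+e = proj₂ (proj₂ spanning)

    trade : ∀ {B x} → Base M B → H - h ⊆ B → x ∈ B → x ∉ H → x ≢ e →
            e ∉ B × Base M (replace B x e)
    trade {B} {x} b H-h⊆B x∈B x∉H x≢e with exchange M B B₀ x b b₀ x∈B x∉B₀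
      where
      x∉B₀ : x ∉ B₀
      x∉B₀ x∈B₀ with ∈-∪⁅⁆⁻ (B₀⊆H+e x∈B₀)
      ... | inj₁ x∈H = x∉H x∈H
      ... | inj₂ x≡e = x≢e x≡e
    ... | y , y∈B₀ , y∉B , b' with ∈-∪⁅⁆⁻ (B₀⊆H+e y∈B₀)
    ... | inj₂ refl = y∉B , b'
    ... | inj₁ y∈H with y ≟ h
    ...   | no  y≢h = ⊥-elim (y∉B (H-h⊆B (x∈p∧x≢y⇒x∈p-y y∈H y≢h)))
    ...   | yes refl = ⊥-elim (H⊈base b' H⊆B')
      where
      H⊆B' : H ⊆ replace B x y
      H⊆B' {z} z∈H with z ≟ y
      ... | yes refl = ∈-replace-new
      ... | no  z≢y  = ∈-replace-kept (H-h⊆B (x∈p∧x≢y⇒x∈p-y z∈H z≢y))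
                                      (λ { refl → x∉H z∈H })

  -- Extend the independent set H - h to a base
  -- and, if needed, trade an element outside H for e; the resulting base
  -- contains X = (H - h) ∪ {e}, and any further element of it could again
  -- only be traded for e, which it already contains.
  replace-base : ∀ {h e} → h ∈ H → e ∉ H → Base M (replace H h e)
  replace-base {h} {e} h∈H e∉H = subst (Base M) (sym X≡B) b
    where
    open TradeTowards h∈H e∉H
    X = replace H h e

    above : ∃ λ B → Base M B × X ⊆ B
    above with proj₂ (proj₁ ch) (H - h) (x∈p⇒p-x⊂p h∈H)
    ... | B₁ , b₁ , H-h⊆B₁ with e ∈? B₁
    ...   | yes e∈B₁ = B₁ , b₁ , replace-⊆ H-h⊆B₁ e∈B₁
    ...   | no  e∉B₁ with base-meets-outside b₁
    ...     | f , f∈B₁ , f∉H =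
      replace B₁ f e , proj₂ (trade b₁ H-h⊆B₁ f∈B₁ f∉H (λ { refl → e∉B₁ f∈B₁ })) ,
      replace-⊆ (λ x∈H-h → ∈-replace-kept (H-h⊆B₁ x∈H-h)
                             (λ { refl → f∉H (proj₁ (∈-remove⁻ x∈H-h)) }))
                ∈-replace-new

    B = proj₁ above
    b = proj₁ (proj₂ above)
    X⊆B : X ⊆ B
    X⊆B = proj₂ (proj₂ above)

    B⊆X : B ⊆ X
    B⊆X {x} x∈B with x ∈? X
    ... | yes x∈X = x∈X
    ... | no  x∉X = ⊥-elim (proj₁ (trade b H-h⊆B x∈B x∉H x≢e) (X⊆B ∈-replace-new))
      where
      H-h⊆B : H - h ⊆ B
      H-h⊆B = X⊆B ∘ ∈-∪⁅⁆-old
      x≢e : x ≢ e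
      x≢e refl = x∉X ∈-replace-new
      x∉H : x ∉ H
      x∉H x∈H with x ≟ h
      ... | no  x≢h = x∉X (∈-replace-kept x∈H x≢h)
      ... | yes refl = H⊈base b λ {z} z∈H → case z ≟ x of λ
        { (yes refl) → x∈B
        ; (no z≢x)   → X⊆B (∈-replace-kept z∈H z≢x) }

    X≡B : X ≡ B
    X≡B = ⊆-antisym X⊆B B⊆X

  IsReplacement : Subset m → Set
  IsReplacement X = ∃ λ h → ∃ λ e → h ∈ H × e ∉ H × X ≡ replace H h e

  base⇔replacement : OneOutside M H → ∀ X → Base M X ⇔ IsReplacement X
  base⇔replacement one-outside X = mk⇔ to λ (h , e , h∈H , e∉H , X≡) →
    subst (Base M) (sym X≡) (replace-base h∈H e∉H)
    where
    to : Base M X → IsReplacement X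
    to b with base-misses-H b | base-meets-outside b
    ... | h , h∈H , h∉X | e , e∈X , e∉H =
      h , e , h∈H , e∉H , base-⊆-base M b (replace-base h∈H e∉H) X⊆
      where
      X⊆ : X ⊆ replace H h e
      X⊆ {x} x∈X with x ∈? H
      ... | yes x∈H = ∈-replace-kept x∈H λ { refl → h∉X x∈X }
      ... | no  x∉H rewrite one-outside b x∈X e∈X x∉H e∉H = ∈-replace-new

module Relaxation {m : ℕ} {M M' : Matroid m} {H : Subset m}
                  (ch : IsCircuitHyperplane M H) (rel : IsRelaxation M H M') where
  open CircuitHyperplane M ch

  base→base' : ∀ {X} → Base M X → Base M' X
  base→base' b = Equivalence.from (rel _) (inj₁ b)

  H-base' : Base M' H
  H-base' = Equivalence.from (rel H) (inj₂ refl)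

  base'-cases : ∀ {X} → Base M' X → Base M X ⊎ X ≡ H
  base'-cases = Equivalence.to (rel _)

  H+e-circuit' : ∀ {e} → e ∉ H → IsCircuit M' (H ∪ ⁅ e ⁆)
  H+e-circuit' {e} e∉H = dependent , proper-independent
    where
    dependent : ¬ Indep M' (H ∪ ⁅ e ⁆)
    dependent (B , b , H+e⊆B) with base'-cases b
    ... | inj₁ bM   = H⊈base bM (H+e⊆B ∘ ∈-∪⁅⁆-old)
    ... | inj₂ refl = e∉H (H+e⊆B ∈-∪⁅⁆-new)
    proper-independent : ∀ Y → Y ⊂ H ∪ ⁅ e ⁆ → Indep M' Y
    proper-independent Y (Y⊆H+e , x , x∈ , x∉Y) with ∈-∪⁅⁆⁻ x∈
    ... | inj₂ refl = H , H-base' , Y⊆H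
      where
      Y⊆H : Y ⊆ H
      Y⊆H y∈Y with ∈-∪⁅⁆⁻ (Y⊆H+e y∈Y)
      ... | inj₁ y∈H = y∈H
      ... | inj₂ refl = ⊥-elim (x∉Y y∈Y)
    ... | inj₁ x∈H = replace H x e , base→base' (replace-base x∈H e∉H) , Y⊆H-x+e
      where
      Y⊆H-x+e : Y ⊆ replace H x e
      Y⊆H-x+e y∈Y with ∈-∪⁅⁆⁻ (Y⊆H+e y∈Y)
      ... | inj₁ y∈H = ∈-replace-kept y∈H λ { refl → x∉Y y∈Y }
      ... | inj₂ refl = ∈-replace-new

-- Circuits of a binary matroid

module Represented {m r : ℕ} {N : Matroid m} {A : Fin r → Fin m → Bool}
                   (rep : ∀ X → Indep N X ⇔ ColumnsIndep A X) where

  kernel-on-circuit : ∀ {C c} → IsCircuit N C → c ⊆ C → Nonempty c → InKernel A c → c ≡ C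
  kernel-on-circuit {C} {c} circuit c⊆C nonempty Ac≡0 = ⊆-antisym c⊆C C⊆c
    where
    C⊆c : C ⊆ c
    C⊆c {x} x∈C with x ∈? c
    ... | yes x∈c = x∈c
    ... | no  x∉c = ⊥-elim (Equivalence.to (rep (C - x)) (proj₂ circuit (C - x) (x∈p⇒p-x⊂p x∈C))
                      c (λ y∈c → x∈p∧x≢y⇒x∈p-y (c⊆C y∈c) λ { refl → x∉c y∈c })
                      nonempty Ac≡0)

  circuit-in-kernel : ∀ {C} → IsCircuit N C → ¬ ¬ InKernel A C
  circuit-in-kernel {C} circuit ¬AC≡0 = proj₁ circuit (Equivalence.from (rep C)
    λ c c⊆C nonempty Ac≡0 →
      ¬AC≡0 (subst (InKernel A) (kernel-on-circuit circuit c⊆C nonempty Ac≡0) Ac≡0))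

  circuit-sum-dependent : ∀ {C₁ C₂} → IsCircuit N C₁ → IsCircuit N C₂ →
                          Nonempty (C₁ Δ C₂) → ¬ Indep N (C₁ Δ C₂)
  circuit-sum-dependent {C₁} {C₂} circuit₁ circuit₂ nonempty indep =
    circuit-in-kernel circuit₁ λ AC₁≡0 →
    circuit-in-kernel circuit₂ λ AC₂≡0 →
    Equivalence.to (rep (C₁ Δ C₂)) indep (C₁ Δ C₂) (λ x∈ → x∈) nonempty
      (kernel-Δ A {C₁} {C₂} AC₁≡0 AC₂≡0)

-- If the relaxation M' is binary, then no base of M has two elements
-- outside H: for e ≠ f outside H the circuits H ∪ {e} and H ∪ {f} of M' add
-- up to {e, f}, which would then be dependent in M'.
binary-relaxation⇒one-outside : ∀ {m} {M M' : Matroid m} {H} →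
  IsCircuitHyperplane M H → IsRelaxation M H M' → IsBinary M' → OneOutside M H
binary-relaxation⇒one-outside {M = M} {M'} {H} ch rel (_ , A , rep) {B} {e} {f} b e∈B f∈B e∉H f∉H
  with e ≟ f
... | yes e≡f = e≡f
... | no  e≢f = ⊥-elim (circuit-sum-dependent (H+e-circuit' e∉H) (H+e-circuit' f∉H)
                          (e , ∈-Δ⁺ ∈-∪⁅⁆-new e∉H+f) (B , base→base' b , sum⊆B))
  where
  open Relaxation {M = M} {M'} ch rel
  open Represented {N = M'} {A = A} rep
  e∉H+f : e ∉ H ∪ ⁅ f ⁆
  e∉H+f e∈ with ∈-∪⁅⁆⁻ e∈
  ... | inj₁ e∈H = e∉H e∈H
  ... | inj₂ e≡f = e≢f e≡f
  sum⊆B : (H ∪ ⁅ e ⁆) Δ (H ∪ ⁅ f ⁆) ⊆ B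
  sum⊆B x∈ with ∈-Δ⁻ x∈
  ... | inj₁ (x∈H+e , x∉H+f) = case ∈-∪⁅⁆⁻ x∈H+e of λ
    { (inj₁ x∈H) → ⊥-elim (x∉H+f (∈-∪⁅⁆-old x∈H)) ; (inj₂ refl) → e∈B }
  ... | inj₂ (x∉H+e , x∈H+f) = case ∈-∪⁅⁆⁻ x∈H+f of λ
    { (inj₁ x∈H) → ⊥-elim (x∉H+e (∈-∪⁅⁆-old x∈H)) ; (inj₂ refl) → f∈B }

-- A GF(2)-representation of the relaxation

module RelaxationMatrix {m : ℕ} (H : Subset m) where

  A : Fin m → Fin m → Bool
  A i j = if lookup H j then does (i ≟ j) else lookup H i

  oddOutside : Subset m → Bool
  oddOutside c = Σ₂ λ j → lookup c j ∧ not (lookup H j)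

  linComb-A : ∀ c i → linComb A c i ≡ (lookup c i xor oddOutside c) ∧ lookup H i
  linComb-A c i = begin
    linComb A c i
      ≡⟨ Σ₂-cong (λ j → split (lookup c j) (lookup H j) (does (i ≟ j)) (lookup H i)) ⟩
    Σ₂ (λ j → inside j xor (outside j ∧ lookup H i))
      ≡⟨ Σ₂-xor inside (λ j → outside j ∧ lookup H i) ⟩
    Σ₂ inside xor Σ₂ (λ j → outside j ∧ lookup H i)
      ≡⟨ cong₂ _xor_ inside-sum (Σ₂-∧ʳ outside (lookup H i)) ⟩
    (lookup c i ∧ lookup H i) xor (oddOutside c ∧ lookup H i)
      ≡⟨ ∧-distribʳ-xor (lookup H i) (lookup c i) (oddOutside c) ⟨
    (lookup c i xor oddOutside c) ∧ lookup H i
      ∎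
    where
    open ≡-Reasoning
    inside outside : Fin m → Bool
    inside  j = lookup c j ∧ (lookup H j ∧ does (i ≟ j))
    outside j = lookup c j ∧ not (lookup H j)

    split : ∀ x h u t → x ∧ (if h then u else t) ≡ (x ∧ (h ∧ u)) xor ((x ∧ not h) ∧ t)
    split false h     u t = refl
    split true  true  u t = sym (xor-identityʳ u)
    split true  false u t = refl

    inside-sum : Σ₂ inside ≡ lookup c i ∧ lookup H i
    inside-sum = trans
      (Σ₂-single inside i λ j j≢i → begin
         lookup c j ∧ (lookup H j ∧ does (i ≟ j))
           ≡⟨ cong (λ u → lookup c j ∧ (lookup H j ∧ u)) (dec-false (i ≟ j) (j≢i ∘ sym)) ⟩
         lookup c j ∧ (lookup H j ∧ false)
           ≡⟨ cong (lookup c j ∧_) (∧-zeroʳ (lookup H j)) ⟩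
         lookup c j ∧ false
           ≡⟨ ∧-zeroʳ (lookup c j) ⟩
         false ∎)
      (cong (lookup c i ∧_) (trans (cong (lookup H i ∧_) (dec-true (i ≟ i) refl))
                                   (∧-identityʳ (lookup H i))))

  kernel⇒constant-on-H : ∀ {c} → InKernel A c → ∀ {i} → i ∈ H → lookup c i ≡ oddOutside c
  kernel⇒constant-on-H {c} Ac≡0 {i} i∈H = xor≡false⇒≡ (begin
    lookup c i xor oddOutside c                  ≡⟨ ∧-identityʳ _ ⟨
    (lookup c i xor oddOutside c) ∧ true         ≡⟨ cong ((lookup c i xor oddOutside c) ∧_) ([]=⇒lookup i∈H) ⟨
    (lookup c i xor oddOutside c) ∧ lookup H i   ≡⟨ linComb-A c i ⟨
    linComb A c i                                ≡⟨ Ac≡0 i ⟩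
    false                                        ∎)
    where
    open ≡-Reasoning
    xor≡false⇒≡ : ∀ {x y} → x xor y ≡ false → x ≡ y
    xor≡false⇒≡ {false} {false} _ = refl
    xor≡false⇒≡ {true}  {true}  _ = refl

  constant-on-H⇒kernel : ∀ {c} → (∀ {i} → i ∈ H → lookup c i ≡ oddOutside c) → InKernel A c
  constant-on-H⇒kernel {c} constant i with i ∈? H
  ... | yes i∈H rewrite linComb-A c i | constant i∈H | xor-same (oddOutside c) = refl
  ... | no  i∉H rewrite linComb-A c i | lookup-∉ i∉H = ∧-zeroʳ _

  outside-term-zero : ∀ {c j} → (j ∈ c → j ∈ H) → lookup c j ∧ not (lookup H j) ≡ false
  outside-term-zero {c} {j} j∈c⇒j∈H with j ∈? c
  ... | no  j∉c rewrite lookup-∉ j∉c = refl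
  ... | yes j∈c rewrite []=⇒lookup (j∈c⇒j∈H j∈c) = ∧-zeroʳ _

  oddOutside-⊆H : ∀ {c} → c ⊆ H → oddOutside c ≡ false
  oddOutside-⊆H {c} c⊆H = Σ₂-zero (λ j → lookup c j ∧ not (lookup H j)) λ j → outside-term-zero {c} c⊆H

  oddOutside-⊆H+e : ∀ {c e} → c ⊆ H ∪ ⁅ e ⁆ → e ∉ H → oddOutside c ≡ lookup c e
  oddOutside-⊆H+e {c} {e} c⊆H+e e∉H = begin
    oddOutside c                     ≡⟨ Σ₂-single _ e (λ j j≢e → outside-term-zero (only-e j≢e)) ⟩
    lookup c e ∧ not (lookup H e)    ≡⟨ cong (λ u → lookup c e ∧ not u) (lookup-∉ e∉H) ⟩
    lookup c e ∧ true                ≡⟨ ∧-identityʳ _ ⟩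
    lookup c e                       ∎
    where
    open ≡-Reasoning
    only-e : ∀ {j} → j ≢ e → j ∈ c → j ∈ H
    only-e j≢e j∈c with ∈-∪⁅⁆⁻ (c⊆H+e j∈c)
    ... | inj₁ j∈H = j∈H
    ... | inj₂ j≡e = ⊥-elim (j≢e j≡e)

  column-outside : ∀ {e} → e ∉ H → ∀ i → A i e ≡ lookup H i
  column-outside e∉H i rewrite lookup-∉ e∉H = refl

  pair-kernel : ∀ {e f} → e ∉ H → f ∉ H → InKernel A (⁅ e ⁆ Δ ⁅ f ⁆)
  pair-kernel {e} {f} e∉H f∉H i = begin
    linComb A (⁅ e ⁆ Δ ⁅ f ⁆) i                ≡⟨ linComb-Δ A ⁅ e ⁆ ⁅ f ⁆ i ⟩
    linComb A ⁅ e ⁆ i xor linComb A ⁅ f ⁆ i    ≡⟨ cong₂ _xor_ (linComb-⁅⁆ A e i) (linComb-⁅⁆ A f i) ⟩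
    A i e xor A i f                            ≡⟨ cong₂ _xor_ (column-outside e∉H i) (column-outside f∉H i) ⟩
    lookup H i xor lookup H i                  ≡⟨ xor-same (lookup H i) ⟩
    false                                      ∎
    where open ≡-Reasoning

  H+e-kernel : ∀ {e} → e ∉ H → InKernel A (H ∪ ⁅ e ⁆)
  H+e-kernel {e} e∉H = constant-on-H⇒kernel {H ∪ ⁅ e ⁆} λ {i} i∈H → begin
    lookup (H ∪ ⁅ e ⁆) i              ≡⟨ []=⇒lookup (∈-∪⁅⁆-old i∈H) ⟩
    true                              ≡⟨ []=⇒lookup (∈-∪⁅⁆-new {p = H}) ⟨
    lookup (H ∪ ⁅ e ⁆) e              ≡⟨ oddOutside-⊆H+e {H ∪ ⁅ e ⁆} (λ x∈ → x∈) e∉H ⟨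
    oddOutside (H ∪ ⁅ e ⁆)            ∎
    where open ≡-Reasoning

  H-columnsIndep : ColumnsIndep A H
  H-columnsIndep c c⊆H (x , x∈c) Ac≡0 = true≢false (begin
    true             ≡⟨ []=⇒lookup x∈c ⟨
    lookup c x       ≡⟨ kernel⇒constant-on-H {c} Ac≡0 (c⊆H x∈c) ⟩
    oddOutside c     ≡⟨ oddOutside-⊆H c⊆H ⟩
    false            ∎)
    where open ≡-Reasoning

  replace-columnsIndep : ∀ {h e} → h ∈ H → e ∉ H → ColumnsIndep A (replace H h e)
  replace-columnsIndep {h} {e} h∈H e∉H c c⊆ (x , x∈c) Ac≡0 = c-empty x∈c
    where
    c⊆H+e : c ⊆ H ∪ ⁅ e ⁆
    c⊆H+e y∈c with ∈-replace⁻ (c⊆ y∈c)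
    ... | inj₁ (y∈H , _) = ∈-∪⁅⁆-old y∈H
    ... | inj₂ refl      = ∈-∪⁅⁆-new
    odd≡false : oddOutside c ≡ false
    odd≡false = begin
      oddOutside c   ≡⟨ kernel⇒constant-on-H {c} Ac≡0 h∈H ⟨
      lookup c h     ≡⟨ lookup-∉ (λ h∈c → ∉-replace-old (λ { refl → e∉H h∈H }) (c⊆ h∈c)) ⟩
      false          ∎
      where open ≡-Reasoning
    c-empty : ∀ {x} → x ∉ c
    c-empty {x} x∈c with ∈-replace⁻ (c⊆ x∈c)
    ... | inj₁ (x∈H , _) = true≢false (trans (sym ([]=⇒lookup x∈c))
                                      (trans (kernel⇒constant-on-H {c} Ac≡0 x∈H) odd≡false))
    ... | inj₂ refl      = true≢false (trans (sym ([]=⇒lookup x∈c))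
                                      (trans (sym (oddOutside-⊆H+e c⊆H+e e∉H)) odd≡false))

-- If no base of M has two elements outside H, then A represents M': the
-- bases of M' are H and the trades of H, whose columns are independent, and
-- any other set contains either two equal columns or the columns of some
-- H ∪ {e}, which sum to zero.
one-outside⇒binary-relaxation : ∀ {m} {M M' : Matroid m} {H} →
  IsCircuitHyperplane M H → IsRelaxation M H M' → OneOutside M H → IsBinary M'
one-outside⇒binary-relaxation {m} {M} {M'} {H} ch rel one-outside =
  m , A , λ X → mk⇔ indep⇒columnsIndep columnsIndep⇒indep
  where
  open CircuitHyperplane M ch
  open Relaxation {M = M} {M'} ch rel
  open RelaxationMatrix H

  base'-columnsIndep : ∀ {B} → Base M' B → ColumnsIndep A B
  base'-columnsIndep {B} b with base'-cases b
  ... | inj₂ refl = H-columnsIndep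
  ... | inj₁ bM with Equivalence.to (base⇔replacement one-outside B) bM
  ...   | h , e , h∈H , e∉H , refl = replace-columnsIndep h∈H e∉H

  indep⇒columnsIndep : ∀ {X} → Indep M' X → ColumnsIndep A X
  indep⇒columnsIndep (B , b , X⊆B) c c⊆X = base'-columnsIndep b c (X⊆B ∘ c⊆X)

  columnsIndep⇒indep : ∀ {X} → ColumnsIndep A X → Indep M' X
  columnsIndep⇒indep {X} indep with ⊆-or-witness X H
  ... | inj₁ X⊆H = H , H-base' , X⊆H
  ... | inj₂ (e , e∈X , e∉H) with ⊆-or-witness X (H ∪ ⁅ e ⁆)
  ...   | inj₂ (f , f∈X , f∉H+e) =
    ⊥-elim (indep (⁅ e ⁆ Δ ⁅ f ⁆) pair⊆X (e , ∈-Δ⁺ (x∈⁅x⁆ e) (x≢y⇒x∉⁅y⁆ e≢f))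
                  (pair-kernel e∉H f∉H))
    where
    e≢f : e ≢ f
    e≢f refl = f∉H+e ∈-∪⁅⁆-new
    f∉H : f ∉ H
    f∉H = f∉H+e ∘ ∈-∪⁅⁆-old
    pair⊆X : ⁅ e ⁆ Δ ⁅ f ⁆ ⊆ X
    pair⊆X x∈ with ∈-Δ⁻ x∈
    ... | inj₁ (x∈⁅e⁆ , _) rewrite x∈⁅y⁆⇒x≡y e x∈⁅e⁆ = e∈X
    ... | inj₂ (_ , x∈⁅f⁆) rewrite x∈⁅y⁆⇒x≡y f x∈⁅f⁆ = f∈X
  ...   | inj₁ X⊆H+e with ⊆-or-witness H X
  ...     | inj₂ (h , h∈H , h∉X) = replace H h e , base→base' (replace-base h∈H e∉H) , X⊆H-h+e
    where
    X⊆H-h+e : X ⊆ replace H h e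
    X⊆H-h+e x∈X with ∈-∪⁅⁆⁻ (X⊆H+e x∈X)
    ... | inj₁ x∈H = ∈-replace-kept x∈H λ { refl → h∉X x∈X }
    ... | inj₂ refl = ∈-replace-new
  ...     | inj₁ H⊆X =
    ⊥-elim (indep (H ∪ ⁅ e ⁆) H+e⊆X (e , ∈-∪⁅⁆-new) (H+e-kernel e∉H))
    where
    H+e⊆X : H ∪ ⁅ e ⁆ ⊆ X
    H+e⊆X x∈ with ∈-∪⁅⁆⁻ x∈
    ... | inj₁ x∈H = H⊆X x∈H
    ... | inj₂ refl = e∈X

lookup-take : ∀ {A : Set} n {k} (Y : Vec A (n + k)) i → lookup (take n Y) i ≡ lookup Y (i ↑ˡ k)
lookup-take (suc n) (y ∷ Y) zero    = refl
lookup-take (suc n) (y ∷ Y) (suc i) = lookup-take n Y i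

lookup-drop : ∀ {A : Set} n {k} (Y : Vec A (n + k)) j → lookup (drop n Y) j ≡ lookup Y (n ↑ʳ j)
lookup-drop zero    Y       j = refl
lookup-drop (suc n) (y ∷ Y) j = lookup-drop n Y j

module Blocks {m : ℕ} (n k : ℕ) (σ : Fin m ↔ Fin (n + k)) where
  open Inverse σ using (to; from; strictlyInverseˡ; strictlyInverseʳ)

  left : Fin n → Fin m
  left i = from (i ↑ˡ k)

  right : Fin k → Fin m
  right j = from (n ↑ʳ j)

  InLeft InRight : Fin m → Set
  InLeft  x = ∃ λ i → left i ≡ x
  InRight x = ∃ λ j → right j ≡ x

  from-injective : ∀ {y y'} → from y ≡ from y' → y ≡ y'
  from-injective {y} {y'} eq =
    trans (sym (strictlyInverseˡ y)) (trans (cong to eq) (strictlyInverseˡ y'))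

  left-injective : ∀ {i i'} → left i ≡ left i' → i ≡ i'
  left-injective eq = ↑ˡ-injective k _ _ (from-injective eq)

  right-injective : ∀ {j j'} → right j ≡ right j' → j ≡ j'
  right-injective eq = ↑ʳ-injective n _ _ (from-injective eq)

  left≢right : ∀ {i j} → left i ≢ right j
  left≢right {i} {j} eq with
    trans (sym (splitAt-↑ˡ n i k)) (trans (cong (splitAt n) (from-injective eq)) (splitAt-↑ʳ n k j))
  ... | ()

  not-left-and-right : ∀ {x} → InLeft x → InRight x → ⊥
  not-left-and-right (i , refl) (j , eq) = left≢right (sym eq)

  cover : ∀ x → InLeft x ⊎ InRight x
  cover x with splitAt n (to x) in eq
  ... | inj₁ i = inj₁ (i , trans (cong from (splitAt⁻¹-↑ˡ eq)) (strictlyInverseʳ x))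
  ... | inj₂ j = inj₂ (j , trans (cong from (splitAt⁻¹-↑ʳ eq)) (strictlyInverseʳ x))

  BlockBase : Subset m → Set
  BlockBase X = ∣ restrict left X ∣ ≡ n ∸ 1 × ∣ restrict right X ∣ ≡ 1

  directSum≡blockBase : ∀ X →
    DirectSumBase (UniformBase (n ∸ 1) n) (UniformBase 1 k) (image σ X) ≡ BlockBase X
  directSum≡blockBase X =
    cong₂ (λ L R → ∣ L ∣ ≡ n ∸ 1 × ∣ R ∣ ≡ 1) take-image drop-image
    where
    take-image : take n (image σ X) ≡ restrict left X
    take-image = trans (sym (tabulate∘lookup _)) (tabulate-cong λ i →
      trans (lookup-take n (image σ X) i) (lookup∘tabulate _ (i ↑ˡ k)))
    drop-image : drop n (image σ X) ≡ restrict right X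
    drop-image = trans (sym (tabulate∘lookup _)) (tabulate-cong λ j →
      trans (lookup-drop n (image σ X) j) (lookup∘tabulate _ (n ↑ʳ j)))

iso⇔blockBases : ∀ {m} {M : Matroid m} {n k} →
  IsoToU⊕U M n k ⇔ Σ (Fin m ↔ Fin (n + k)) λ σ → ∀ X → Base M X ⇔ Blocks.BlockBase n k σ X
iso⇔blockBases {M = M} {n} {k} = mk⇔
  (λ (σ , iso) → σ , λ X → subst (Base M X ⇔_) (directSum≡blockBase n k σ X) (iso X))
  (λ (σ , iso) → σ , λ X → subst (Base M X ⇔_) (sym (directSum≡blockBase n k σ X)) (iso X))
  where open Blocks using (directSum≡blockBase)

one-block-outside : ∀ {m a} {M : Matroid m} {H} (f : Fin a → Fin m) →
  (∀ {X} → Base M X → ∣ restrict f X ∣ ≡ 1) → (∀ {x} → x ∉ H → ∃ λ i → f i ≡ x) →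
  OneOutside M H
one-block-outside f size-one in-block {B} b e∈B e'∈B e∉H e'∉H
  with in-block e∉H | in-block e'∉H | ∣p∣≡1⇒singleton (restrict f B) (size-one b)
... | i , refl | i' , refl | i₀ , B≡⁅i₀⁆ =
  cong f (trans (at-i₀ (∈-restrict⁺ e∈B)) (sym (at-i₀ (∈-restrict⁺ e'∈B))))
  where
  at-i₀ : ∀ {i} → i ∈ restrict f B → i ≡ i₀
  at-i₀ {i} i∈ = x∈⁅y⁆⇒x≡y i₀ (subst (i ∈_) B≡⁅i₀⁆ i∈)

-- Base
-- exchanges cannot move between the blocks, so H lies in one block and its
-- complement in one block; these blocks differ, and the one holding the
-- complement has size one in every base.
module BlockBasesThroughH {m n k : ℕ} {M : Matroid m} {H : Subset m}
    (ch : IsCircuitHyperplane M H) (σ : Fin m ↔ Fin (n + k))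
    (blockBase : ∀ {X} → Base M X → Blocks.BlockBase n k σ X) where
  open Blocks n k σ
  open CircuitHyperplane M ch

  SameBlock : Fin m → Fin m → Set
  SameBlock u v = (InLeft u × InLeft v) ⊎ (InRight u × InRight v)

  stay-left : ∀ {u v} → InLeft u → SameBlock u v → InLeft v
  stay-left _      (inj₁ (_ , left-v))   = left-v
  stay-left left-u (inj₂ (right-u , _))  = ⊥-elim (not-left-and-right left-u right-u)

  stay-right : ∀ {u v} → InRight u → SameBlock u v → InRight v
  stay-right right-u (inj₁ (left-u , _))  = ⊥-elim (not-left-and-right left-u right-u)
  stay-right _       (inj₂ (_ , right-v)) = right-v

  same-block-refl : ∀ u → SameBlock u u
  same-block-refl u with cover u
  ... | inj₁ left-u  = inj₁ (left-u , left-u)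
  ... | inj₂ right-u = inj₂ (right-u , right-u)

  -- A block of constant size cannot lose an element along an exchange.
  exchange-within-block : ∀ {X₁ X₂ u v} → Base M X₁ → Base M X₂ →
    u ∈ X₁ → u ∉ X₂ → X₂ ⊆ X₁ ∪ ⁅ v ⁆ → SameBlock u v
  exchange-within-block {u = u} {v} b₁ b₂ u∈X₁ u∉X₂ X₂⊆ with cover u | cover v
  ... | inj₁ left-u     | inj₁ left-v     = inj₁ (left-u , left-v)
  ... | inj₂ right-u    | inj₂ right-v    = inj₂ (right-u , right-v)
  ... | inj₁ (i , refl) | inj₂ (j , refl) = ⊥-elim (<-irrefl
    (trans (proj₁ (blockBase b₂)) (sym (proj₁ (blockBase b₁))))
    (p⊂q⇒∣p∣<∣q∣ (restrict-⊂ left u∈X₁ u∉X₂ X₂⊆ λ _ → left≢right)))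
  ... | inj₂ (j , refl) | inj₁ (i , refl) = ⊥-elim (<-irrefl
    (trans (proj₂ (blockBase b₂)) (sym (proj₂ (blockBase b₁))))
    (p⊂q⇒∣p∣<∣q∣ (restrict-⊂ right u∈X₁ u∉X₂ X₂⊆ λ _ eq → left≢right (sym eq))))

  h₀ : Fin m
  h₀ = proj₁ (base-misses-H (proj₂ (base-exists M)))
  h₀∈H : h₀ ∈ H
  h₀∈H = proj₁ (proj₂ (base-misses-H (proj₂ (base-exists M))))
  e₀ : Fin m
  e₀ = proj₁ (base-meets-outside (proj₂ (base-exists M)))
  e₀∉H : e₀ ∉ H
  e₀∉H = proj₂ (proj₂ (base-meets-outside (proj₂ (base-exists M))))

  -- Trading h₀ for e or for e' shows that e, e' ∉ H lie in the same block.
  outside-same-block : ∀ {e e'} → e ∉ H → e' ∉ H → SameBlock e e'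
  outside-same-block {e} {e'} e∉H e'∉H with e ≟ e'
  ... | yes refl = same-block-refl e
  ... | no  e≢e' = exchange-within-block (replace-base h₀∈H e∉H) (replace-base h₀∈H e'∉H)
                     ∈-replace-new e∉ ⊆
    where
    e∉ : e ∉ replace H h₀ e'
    e∉ e∈ with ∈-replace⁻ e∈
    ... | inj₁ (e∈H , _) = e∉H e∈H
    ... | inj₂ e≡e'      = e≢e' e≡e'
    ⊆ : replace H h₀ e' ⊆ replace H h₀ e ∪ ⁅ e' ⁆
    ⊆ x∈ with ∈-replace⁻ x∈
    ... | inj₁ (x∈H , x≢h₀) = ∈-∪⁅⁆-old (∈-replace-kept x∈H x≢h₀)
    ... | inj₂ refl         = ∈-∪⁅⁆-new

  -- Trading h or h' for e₀ shows that h, h' ∈ H lie in the same block.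
  H-same-block : ∀ {h h'} → h ∈ H → h' ∈ H → SameBlock h h'
  H-same-block {h} {h'} h∈H h'∈H with h ≟ h'
  ... | yes refl = same-block-refl h
  ... | no  h≢h' = exchange-within-block (replace-base h'∈H e₀∉H) (replace-base h∈H e₀∉H)
                     (∈-replace-kept h∈H h≢h') (∉-replace-old λ { refl → e₀∉H h∈H }) ⊆
    where
    ⊆ : replace H h e₀ ⊆ replace H h' e₀ ∪ ⁅ h' ⁆
    ⊆ {x} x∈ with ∈-replace⁻ x∈ | x ≟ h'
    ... | inj₁ _         | yes refl = ∈-∪⁅⁆-new
    ... | inj₁ (x∈H , _) | no x≢h'  = ∈-∪⁅⁆-old (∈-replace-kept x∈H x≢h')
    ... | inj₂ refl      | _        = ∈-∪⁅⁆-old ∈-replace-new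

  one-outside : Fin k → OneOutside M H
  one-outside j₀ with cover e₀
  ... | inj₂ e₀-right = one-block-outside {M = M} {H} right (proj₂ ∘ blockBase)
                          (λ x∉H → stay-right e₀-right (outside-same-block e₀∉H x∉H))
  ... | inj₁ e₀-left with cover h₀
  ...   | inj₁ h₀-left = ⊥-elim (not-left-and-right (all-left (right j₀)) (j₀ , refl))
    where
    all-left : ∀ x → InLeft x
    all-left x with x ∈? H
    ... | yes x∈H = stay-left h₀-left (H-same-block h₀∈H x∈H)
    ... | no  x∉H = stay-left e₀-left (outside-same-block e₀∉H x∉H)
  ...   | inj₂ h₀-right = one-block-outside {M = M} {H} left size-one
                            (λ x∉H → stay-left e₀-left (outside-same-block e₀∉H x∉H))
    where
    left∉H : ∀ i → left i ∉ H
    left∉H i left-i∈H = not-left-and-right (i , refl)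
                          (stay-right h₀-right (H-same-block h₀∈H left-i∈H))
    n∸1≡1 : n ∸ 1 ≡ 1
    n∸1≡1 = begin
      n ∸ 1                                 ≡⟨ proj₁ (blockBase (replace-base h₀∈H e₀∉H)) ⟨
      ∣ restrict left (replace H h₀ e₀) ∣   ≡⟨ cong ∣_∣ (restrict-replace-outside left-injective left∉H (proj₂ e₀-left)) ⟩
      ∣ ⁅ proj₁ e₀-left ⁆ ∣                 ≡⟨ ∣⁅x⁆∣≡1 (proj₁ e₀-left) ⟩
      1                                     ∎
      where open ≡-Reasoning
    size-one : ∀ {X} → Base M X → ∣ restrict left X ∣ ≡ 1
    size-one b = trans (proj₁ (blockBase b)) n∸1≡1

record Split {m : ℕ} (p : Subset m) : Set where
  field
    a b     : ℕ
    to      : Fin m → Fin a ⊎ Fin b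
    from    : Fin a ⊎ Fin b → Fin m
    to∘from : ∀ y → to (from y) ≡ y
    from∘to : ∀ x → from (to x) ≡ x
    first∈  : ∀ i → from (inj₁ i) ∈ p
    second∉ : ∀ j → from (inj₂ j) ∉ p

  σ : Fin m ↔ Fin (a + b)
  σ = ↔-sym +↔⊎ ↔-∘ mk↔ₛ′ to from to∘from from∘to

split : ∀ {m} (p : Subset m) → Split p
split [] = record
  { a = 0 ; b = 0 ; to = λ () ; from = λ { (inj₁ ()) ; (inj₂ ()) }
  ; to∘from = λ { (inj₁ ()) ; (inj₂ ()) } ; from∘to = λ ()
  ; first∈ = λ () ; second∉ = λ () }
split (true ∷ p) = record
  { a = suc a ; b = b ; to = to' ; from = from' ; to∘from = to∘from' ; from∘to = from∘to'
  ; first∈ = first∈' ; second∉ = λ j → second∉ j ∘ drop-there }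
  where
  open Split (split p)
  to' : Fin (suc _) → Fin (suc a) ⊎ Fin b
  to' zero    = inj₁ zero
  to' (suc x) = Sum.map₁ suc (to x)
  from' : Fin (suc a) ⊎ Fin b → Fin (suc _)
  from' (inj₁ zero)    = zero
  from' (inj₁ (suc i)) = suc (from (inj₁ i))
  from' (inj₂ j)       = suc (from (inj₂ j))
  to∘from' : ∀ y → to' (from' y) ≡ y
  to∘from' (inj₁ zero)    = refl
  to∘from' (inj₁ (suc i)) = cong (Sum.map₁ suc) (to∘from (inj₁ i))
  to∘from' (inj₂ j)       = cong (Sum.map₁ suc) (to∘from (inj₂ j))
  from∘to' : ∀ x → from' (to' x) ≡ x
  from∘to' zero    = refl
  from∘to' (suc x) = trans (shift (to x)) (cong suc (from∘to x))
    where
    shift : ∀ y → from' (Sum.map₁ suc y) ≡ suc (from y)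
    shift (inj₁ i) = refl
    shift (inj₂ j) = refl
  first∈' : ∀ i → from' (inj₁ i) ∈ true ∷ p
  first∈' zero    = here
  first∈' (suc i) = there (first∈ i)
split (false ∷ p) = record
  { a = a ; b = suc b ; to = to' ; from = from' ; to∘from = to∘from' ; from∘to = from∘to'
  ; first∈ = λ i → there (first∈ i) ; second∉ = second∉' }
  where
  open Split (split p)
  to' : Fin (suc _) → Fin a ⊎ Fin (suc b)
  to' zero    = inj₂ zero
  to' (suc x) = Sum.map₂ suc (to x)
  from' : Fin a ⊎ Fin (suc b) → Fin (suc _)
  from' (inj₂ zero)    = zero
  from' (inj₂ (suc j)) = suc (from (inj₂ j))
  from' (inj₁ i)       = suc (from (inj₁ i))
  to∘from' : ∀ y → to' (from' y) ≡ y
  to∘from' (inj₂ zero)    = refl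
  to∘from' (inj₂ (suc j)) = cong (Sum.map₂ suc) (to∘from (inj₂ j))
  to∘from' (inj₁ i)       = cong (Sum.map₂ suc) (to∘from (inj₁ i))
  from∘to' : ∀ x → from' (to' x) ≡ x
  from∘to' zero    = refl
  from∘to' (suc x) = trans (shift (to x)) (cong suc (from∘to x))
    where
    shift : ∀ y → from' (Sum.map₂ suc y) ≡ suc (from y)
    shift (inj₁ i) = refl
    shift (inj₂ j) = refl
  second∉' : ∀ j → from' (inj₂ j) ∉ false ∷ p
  second∉' zero    ()
  second∉' (suc j) (there x∈) = second∉ j x∈

-- If no base of M has two elements outside H, then splitting Fin m into H
-- and its complement exhibits M ≅ U_{|H|-1,|H|} ⊕ U_{1,m-|H|}: the bases
-- (H - h) ∪ {e} are exactly the block bases.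
module OneOutsideIso {m : ℕ} {M : Matroid m} {H : Subset m}
    (ch : IsCircuitHyperplane M H) (one-outside : OneOutside M H) where
  open Split (split H)
  open Blocks a b σ
  open CircuitHyperplane M ch

  left∈H : ∀ i → left i ∈ H
  left∈H i = subst (_∈ H) (cong from (sym (splitAt-↑ˡ a i b))) (first∈ i)

  right∉H : ∀ j → right j ∉ H
  right∉H j = subst (_∉ H) (cong from (sym (splitAt-↑ʳ a b j))) (second∉ j)

  H-left : ∀ {x} → x ∈ H → InLeft x
  H-left {x} x∈H with cover x
  ... | inj₁ left-x     = left-x
  ... | inj₂ (j , refl) = ⊥-elim (right∉H j x∈H)

  outside-right : ∀ {x} → x ∉ H → InRight x
  outside-right {x} x∉H with cover x
  ... | inj₁ (i , refl) = ⊥-elim (x∉H (left∈H i))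
  ... | inj₂ right-x    = right-x

  a≥1 : a ≥ 1
  a≥1 = inhabited (proj₁ (H-left (proj₁ (proj₂ (base-misses-H (proj₂ (base-exists M)))))))

  b≥1 : b ≥ 1
  b≥1 = inhabited (proj₁ (outside-right (proj₂ (proj₂ (base-meets-outside (proj₂ (base-exists M)))))))

  replacement⇒blockBase : ∀ {X} → IsReplacement X → BlockBase X
  replacement⇒blockBase (h , e , h∈H , e∉H , refl) with H-left h∈H | outside-right e∉H
  ... | i , left-i≡h | j , right-j≡e =
    trans (cong ∣_∣ (restrict-replace-inside left-injective left∈H left-i≡h e∉H))
          (trans (∣∁p∣≡n∸∣p∣ ⁅ i ⁆) (cong (a ∸_) (∣⁅x⁆∣≡1 i))) ,
    trans (cong ∣_∣ (restrict-replace-outside right-injective right∉H right-j≡e)) (∣⁅x⁆∣≡1 j)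

  complement-size : ∀ {X} → ∣ restrict left X ∣ ≡ a ∸ 1 → ∣ ∁ (restrict left X) ∣ ≡ 1
  complement-size {X} size-left =
    trans (∣∁p∣≡n∸∣p∣ (restrict left X)) (trans (cong (a ∸_) size-left) (m∸[m∸n]≡n a≥1))

  -- A block base misses exactly one left element left i and contains exactly
  -- one right element right j, so it is the trade (H - left i) ∪ {right j}.
  blockBase⇒replacement : ∀ {X} → BlockBase X → IsReplacement X
  blockBase⇒replacement {X} (size-left , size-right)
    with ∣p∣≡1⇒singleton (∁ (restrict left X)) (complement-size {X} size-left)
       | ∣p∣≡1⇒singleton (restrict right X) size-right
  ... | i , ∁L≡⁅i⁆ | j , R≡⁅j⁆ =
    left i , right j , left∈H i , right∉H j , ⊆-antisym X⊆ ⊆X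
    where
    left∈X⇔ : ∀ i' → (left i' ∈ X → i' ≢ i) × (i' ≢ i → left i' ∈ X)
    left∈X⇔ i' =
      (λ l∈X → λ { refl → x∈p⇒x∉∁p (∈-restrict⁺ l∈X) (subst (i ∈_) (sym ∁L≡⁅i⁆) (x∈⁅x⁆ i)) }) ,
      (λ i'≢i → ∈-restrict⁻ (x∉∁p⇒x∈p λ i'∈ → i'≢i (x∈⁅y⁆⇒x≡y i (subst (i' ∈_) ∁L≡⁅i⁆ i'∈))))
    right∈X⇔ : ∀ j' → (right j' ∈ X → j' ≡ j) × (j' ≡ j → right j' ∈ X)
    right∈X⇔ j' =
      (λ r∈X → x∈⁅y⁆⇒x≡y j (subst (j' ∈_) R≡⁅j⁆ (∈-restrict⁺ r∈X))) ,
      (λ { refl → ∈-restrict⁻ (subst (j ∈_) (sym R≡⁅j⁆) (x∈⁅x⁆ j)) })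
    X⊆ : X ⊆ replace H (left i) (right j)
    X⊆ {x} x∈X with cover x
    ... | inj₁ (i' , refl) = ∈-replace-kept (left∈H i') (proj₁ (left∈X⇔ i') x∈X ∘ left-injective)
    ... | inj₂ (j' , refl) rewrite proj₁ (right∈X⇔ j') x∈X = ∈-replace-new
    ⊆X : replace H (left i) (right j) ⊆ X
    ⊆X x∈ with ∈-replace⁻ x∈
    ... | inj₂ refl = proj₂ (right∈X⇔ j) refl
    ... | inj₁ (x∈H , x≢left-i) with H-left x∈H
    ...   | i' , refl = proj₂ (left∈X⇔ i') λ { refl → x≢left-i refl }

  iso : IsoToU⊕U M a b
  iso = Equivalence.from (iso⇔blockBases {M = M} {a} {b}) (σ , λ X →
    ⇔-trans (base⇔replacement one-outside X)
            (mk⇔ (replacement⇒blockBase {X}) (blockBase⇒replacement {X})))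

  U⊕U : ∃ λ n → ∃ λ k → n ≥ 1 × k ≥ 1 × IsoToU⊕U M n k
  U⊕U = a , b , a≥1 , b≥1 , iso

one-outside⇒U⊕U : ∀ {m} {M : Matroid m} {H} → IsCircuitHyperplane M H → OneOutside M H →
  ∃ λ n → ∃ λ k → n ≥ 1 × k ≥ 1 × IsoToU⊕U M n k
one-outside⇒U⊕U {M = M} = OneOutsideIso.U⊕U {M = M}

U⊕U⇒one-outside : ∀ {m} {M : Matroid m} {H} → IsCircuitHyperplane M H →
  (∃ λ n → ∃ λ k → n ≥ 1 × k ≥ 1 × IsoToU⊕U M n k) → OneOutside M H
U⊕U⇒one-outside {M = M} ch (n , k , _ , k≥1 , iso)
  with Equivalence.to (iso⇔blockBases {M = M} {n} {k}) iso
... | σ , bases = BlockBasesThroughH.one-outside {n = n} {k} {M} ch σ (Equivalence.to (bases _)) (fromℕ< k≥1)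

corollary2p7 : ∀ {m : ℕ} (M : Matroid m) (H : Subset m) (M' : Matroid m) →
    IsBinary M → IsCircuitHyperplane M H → IsRelaxation M H M' →
    (IsBinary M' ⇔ (∃ λ n → ∃ λ k → n ≥ 1 × k ≥ 1 × IsoToU⊕U M n k))
corollary2p7 M H M' _ ch rel = mk⇔
  (one-outside⇒U⊕U {M = M} ch ∘ binary-relaxation⇒one-outside {M = M} {M'} ch rel)
  (one-outside⇒binary-relaxation {M = M} {M'} ch rel ∘ U⊕U⇒one-outside {M = M} ch)
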